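{- Let $\sigma$ be a permutation. Then (1) the rows of $\sigma$ are decreasing if $\sigma\in\mathrm{Av}(2314)$; (2) the columns of $\sigma$ are decreasing if $\sigma\in\mathrm{Av}(3124)$; (3) the rows of $\sigma$ are increasing if $\sigma\in\mathrm{Av}(2413)$; (4) the columns of $\sigma$ are increasing if $\sigma\in\mathrm{Av}(3142)$.
   Context: A permutation avoids $\pi$ if no subsequence has the same relative order as $\pi$; $\mathrm{Av}(\pi)$ is the set of such permutations. A left-to-right minimum of $\sigma$ is an entry $\sigma_i$ with $\sigma_j>\sigma_i$ for all $j<i$. Let $\sigma$ have $n$ left-to-right minima at positions $p_1<\dots<p_n$ with values $v_1>\dots>v_n$, and let $B_n=\{(i,j):1\le i\le j\le n\}$ (row $i$, column $j$, row 1 on top). Each entry $\sigma_k$ that is not a left-to-right minimum lies in cell $(i,j)$, where $j$ is the largest index with $p_j<k$ and $i$ the smallest index with $v_i<\sigma_k$. Row $i$ of $\sigma$ is decreasing (resp. increasing) if for all $j<\ell$ every entry in cell $(i,j)$ is larger (resp. smaller) than every entry in cell $(i,\ell)$. Column $j$ is decreasing (resp. increasing) if for all $i>k$ every entry in cell $(i,j)$ lies to the right (resp. left) of every entry in cell $(k,j)$. The rows (columns) of $\sigma$ are decreasing/increasing if every row (column) is. -}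

module Defs where

open import Data.Nat as ℕ using (ℕ; suc)
open import Data.Fin using (Fin; toℕ; _<_; _<?_)
open import Data.Fin.Properties using (all?)
open import Data.Fin.Permutation using (Permutation′; _⟨$⟩ʳ_)
open import Data.Vec using (Vec; lookup; _∷_; [])
open import Data.List using (List; length; filter; allFin)
open import Data.Product using (∃; _×_; _,_)
open import Relation.Nullary using (¬_; Dec)
open import Relation.Nullary.Decidable using (_→-dec_; _×-dec_)
open import Relation.Binary.PropositionalEquality using (_≡_)

-- A permutation of [n] is a library permutation of Fin n; σ(k) = σ ⟨$⟩ʳ k.
-- Positions and values are compared via Fin's _<_ (i.e. via toℕ).

-- A pattern of length k is given by its sequence of (distinct) values.
-- σ contains π if some strictly increasing choice of positions
-- f : Fin k → Fin n gives a subsequence with the same relative order as π.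
Contains : ∀ {n k} → Permutation′ n → Vec ℕ k → Set
Contains {n} {k} σ π =
  ∃ λ (f : Fin k → Fin n) →
    (∀ a b → a < b → f a < f b) ×
    (∀ a b → (lookup π a ℕ.< lookup π b → σ ⟨$⟩ʳ f a < σ ⟨$⟩ʳ f b) ×
             (σ ⟨$⟩ʳ f a < σ ⟨$⟩ʳ f b → lookup π a ℕ.< lookup π b))

Avoids : ∀ {n k} → Permutation′ n → Vec ℕ k → Set
Avoids σ π = ¬ Contains σ π

p2314 p3124 p2413 p3142 : Vec ℕ 4
p2314 = 2 ∷ 3 ∷ 1 ∷ 4 ∷ []
p3124 = 3 ∷ 1 ∷ 2 ∷ 4 ∷ []
p2413 = 2 ∷ 4 ∷ 1 ∷ 3 ∷ []
p3142 = 3 ∷ 1 ∷ 4 ∷ 2 ∷ []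

IsLRMin : ∀ {n} → Permutation′ n → Fin n → Set
IsLRMin σ k = ∀ j → j < k → σ ⟨$⟩ʳ k < σ ⟨$⟩ʳ j

isLRMin? : ∀ {n} (σ : Permutation′ n) (k : Fin n) → Dec (IsLRMin σ k)
isLRMin? σ k = all? (λ j → (j <? k) →-dec (σ ⟨$⟩ʳ k <? σ ⟨$⟩ʳ j))

-- Let the LR minima be at positions p₁ < … < p_m with values v₁ > … > v_m.
-- Column index of the entry at position k: the largest j with p_j < k,
-- which is the number of LR minima at positions before k.
column : ∀ {n} → Permutation′ n → Fin n → ℕ
column {n} σ k =
  length (filter (λ j → (j <? k) ×-dec isLRMin? σ j) (allFin n))

-- Row index of the entry at position k: the smallest i with v_i < σ(k),
-- which is 1 + the number of LR minima with value greater than σ(k)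
-- (since v₁ > v₂ > …, those are exactly v₁, …, v_{i-1}).
row : ∀ {n} → Permutation′ n → Fin n → ℕ
row {n} σ k =
  suc (length (filter (λ j → (σ ⟨$⟩ʳ k <? σ ⟨$⟩ʳ j) ×-dec isLRMin? σ j) (allFin n)))

-- Entries that are not left-to-right minima (these are the ones placed in cells).
NonMin : ∀ {n} → Permutation′ n → Fin n → Set
NonMin σ k = ¬ IsLRMin σ k

RowsDecreasing : ∀ {n} → Permutation′ n → Set
RowsDecreasing σ = ∀ x y → NonMin σ x → NonMin σ y →
  row σ x ≡ row σ y → column σ x ℕ.< column σ y → σ ⟨$⟩ʳ y < σ ⟨$⟩ʳ x

RowsIncreasing : ∀ {n} → Permutation′ n → Set
RowsIncreasing σ = ∀ x y → NonMin σ x → NonMin σ y →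
  row σ x ≡ row σ y → column σ x ℕ.< column σ y → σ ⟨$⟩ʳ x < σ ⟨$⟩ʳ y

ColumnsDecreasing : ∀ {n} → Permutation′ n → Set
ColumnsDecreasing σ = ∀ x y → NonMin σ x → NonMin σ y →
  column σ x ≡ column σ y → row σ y ℕ.< row σ x → y < x

ColumnsIncreasing : ∀ {n} → Permutation′ n → Set
ColumnsIncreasing σ = ∀ x y → NonMin σ x → NonMin σ y →
  column σ x ≡ column σ y → row σ y ℕ.< row σ x → x < y

module Submission where

-- A non-minimal entry x always has a left-to-right minimum w to its left and below it.
-- Columns and rows count left-to-right minima, so a strict difference of columns (rows)
-- yields a left-to-right minimum strictly between two entries in position (value), while
-- equal columns (rows) keep every such minimum on the same side of both entries.  If a
-- row or column were out of order, these minima together with x and y would form an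
-- occurrence of the forbidden pattern.

open import Defs
open import Data.Nat as ℕ using (ℕ; suc; z≤n; s≤s)
import Data.Nat.Properties as ℕ
open import Data.Fin as F using (Fin; zero; suc; toℕ; inject₁; _<_; _<?_; #_)
open import Data.Fin.Properties
  using (<-cmp; <-trans; <-asym; <-irrefl; ≤∧≢⇒<; all?; ¬∀⟶∃¬)
open import Data.Fin.Patterns using (0F; 1F; 2F; 3F)
open import Data.Fin.Induction using (<-wellFounded)
open import Data.Fin.Permutation using (Permutation′; _⟨$⟩ʳ_)
open import Data.List using ([]; _∷_; length; filter; allFin)
open import Data.List.Membership.Propositional using (_∈_)
open import Data.List.Membership.Propositional.Properties using (∈-allFin)
open import Data.List.Relation.Unary.Any using (here; there)
open import Data.Vec using (Vec; lookup; _∷_; [])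
open import Data.Product using (∃; _×_; _,_)
open import Data.Empty using (⊥-elim)
open import Function using (_∘_)
open import Function.Bundles using (Injection)
open import Function.Properties.Inverse using (↔⇒↣)
open import Induction.WellFounded as WF
open import Relation.Binary.Core using (Rel)
open import Relation.Binary.Definitions using (Transitive; tri<; tri≈; tri>)
open import Relation.Binary.PropositionalEquality using (_≡_; _≢_; refl; sym; trans; cong; subst)
open import Relation.Nullary using (¬_; yes; no)
open import Relation.Nullary.Decidable using (True; toWitness; _×-dec_; _→-dec_)
open import Relation.Unary using (Pred; Decidable; _⊆_)

module _ {a p q} {A : Set a} {P : Pred A p} {Q : Pred A q}
         (P? : Decidable P) (Q? : Decidable Q) where

  length-filter-mono : P ⊆ Q → ∀ xs → length (filter P? xs) ℕ.≤ length (filter Q? xs)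
  length-filter-mono P⊆Q [] = z≤n
  length-filter-mono P⊆Q (x ∷ xs) with P? x | Q? x
  ... | yes _  | yes _  = s≤s (length-filter-mono P⊆Q xs)
  ... | yes Px | no ¬Qx = ⊥-elim (¬Qx (P⊆Q Px))
  ... | no _   | yes _  = ℕ.m≤n⇒m≤1+n (length-filter-mono P⊆Q xs)
  ... | no _   | no _   = length-filter-mono P⊆Q xs

  length-filter-mono-< : P ⊆ Q → ∀ {z xs} → z ∈ xs → Q z → ¬ P z →
                         length (filter P? xs) ℕ.< length (filter Q? xs)
  length-filter-mono-< P⊆Q {xs = x ∷ xs} z∈ Qz ¬Pz with P? x | Q? x | z∈
  ... | yes _  | yes _  | there z∈xs = s≤s (length-filter-mono-< P⊆Q z∈xs Qz ¬Pz)
  ... | yes Px | yes _  | here refl  = ⊥-elim (¬Pz Px)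
  ... | yes Px | no ¬Qx | _          = ⊥-elim (¬Qx (P⊆Q Px))
  ... | no _   | yes _  | here refl  = s≤s (length-filter-mono P⊆Q xs)
  ... | no _   | yes _  | there z∈xs = ℕ.m≤n⇒m≤1+n (length-filter-mono-< P⊆Q z∈xs Qz ¬Pz)
  ... | no _   | no ¬Qx | here refl  = ⊥-elim (¬Qx Qz)
  ... | no _   | no _   | there z∈xs = length-filter-mono-< P⊆Q z∈xs Qz ¬Pz

  length-filter-<⇒∃ : ∀ xs → length (filter P? xs) ℕ.< length (filter Q? xs) →
                      ∃ λ z → Q z × ¬ P z
  length-filter-<⇒∃ (x ∷ xs) lt with P? x | Q? x
  ... | yes _ | yes _  = length-filter-<⇒∃ xs (ℕ.s<s⁻¹ lt)
  ... | yes _ | no _   = length-filter-<⇒∃ xs (ℕ.<-trans (ℕ.n<1+n _) lt)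
  ... | no ¬Px | yes Qx = x , Qx , ¬Px
  ... | no _  | no _   = length-filter-<⇒∃ xs lt

module _ {a ℓ} {A : Set a} {_≺_ : Rel A ℓ} (≺-trans : Transitive _≺_) where

  steps⇒strictlyIncreasing : ∀ {m} {h : Fin (suc m) → A} →
                             (∀ i → h (inject₁ i) ≺ h (suc i)) → ∀ {i j} → i < j → h i ≺ h j
  steps⇒strictlyIncreasing step {zero} {suc zero} _ = step zero
  steps⇒strictlyIncreasing {suc m} {h} step {zero} {suc (suc j)} _ =
    ≺-trans (step zero)
            (steps⇒strictlyIncreasing {h = h ∘ suc} (step ∘ suc) {zero} {suc j} (s≤s z≤n))
  steps⇒strictlyIncreasing {suc m} {h} step {suc i} {suc j} i<j =
    steps⇒strictlyIncreasing {h = h ∘ suc} (step ∘ suc) (ℕ.s<s⁻¹ i<j)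

chain₄ : ∀ {n} {h : Fin 4 → Fin n} → h 0F < h 1F → h 1F < h 2F → h 2F < h 3F →
         ∀ {i j} → i < j → h i < h j
chain₄ {h = h} h₀<h₁ h₁<h₂ h₂<h₃ =
  steps⇒strictlyIncreasing {_≺_ = _<_} <-trans {h = h}
    λ { 0F → h₀<h₁ ; 1F → h₁<h₂ ; 2F → h₂<h₃ }

-- A pattern of length k whose entries are 1, …, k; unrank v is the position of the entry v + 1.
record Ranking {k} (π : Vec ℕ k) : Set where
  field
    rank unrank : Fin k → Fin k
    lookup≡1+rank : ∀ i → lookup π i ≡ suc (toℕ (rank i))
    unrank∘rank   : ∀ i → unrank (rank i) ≡ i

ranking : ∀ {k} (π : Vec ℕ k) (rank unrank : Vec (Fin k) k) →
          {True (all? λ i → lookup π i ℕ.≟ suc (toℕ (lookup rank i)))} →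
          {True (all? λ i → lookup unrank (lookup rank i) F.≟ i)} →
          Ranking π
ranking π rank unrank {π≡1+rank} {unrank∘rank} = record
  { rank = lookup rank ; unrank = lookup unrank
  ; lookup≡1+rank = toWitness π≡1+rank ; unrank∘rank = toWitness unrank∘rank }

ranking2314 : Ranking p2314
ranking2314 = ranking p2314 (# 1 ∷ # 2 ∷ # 0 ∷ # 3 ∷ []) (# 2 ∷ # 0 ∷ # 1 ∷ # 3 ∷ [])

ranking3124 : Ranking p3124
ranking3124 = ranking p3124 (# 2 ∷ # 0 ∷ # 1 ∷ # 3 ∷ []) (# 1 ∷ # 2 ∷ # 0 ∷ # 3 ∷ [])

ranking2413 : Ranking p2413
ranking2413 = ranking p2413 (# 1 ∷ # 3 ∷ # 0 ∷ # 2 ∷ []) (# 2 ∷ # 0 ∷ # 3 ∷ # 1 ∷ [])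

ranking3142 : Ranking p3142
ranking3142 = ranking p3142 (# 2 ∷ # 0 ∷ # 3 ∷ # 1 ∷ []) (# 1 ∷ # 3 ∷ # 0 ∷ # 2 ∷ [])

≮∧≢⇒< : ∀ {n} {i j : Fin n} → ¬ j < i → i ≢ j → i < j
≮∧≢⇒< j≮i i≢j = ≤∧≢⇒< (ℕ.≮⇒≥ j≮i) i≢j

module _ {n : ℕ} (σ : Permutation′ n) where

  σ-injective : ∀ {i j} → σ ⟨$⟩ʳ i ≡ σ ⟨$⟩ʳ j → i ≡ j
  σ-injective = Injection.injective (↔⇒↣ σ)

  contains-by-chains : ∀ {k} {π : Vec ℕ k} (ρ : Ranking π) (f : Fin k → Fin n) →
                       (∀ {i j} → i < j → f i < f j) →
                       (∀ {u v} → u < v →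
                          σ ⟨$⟩ʳ f (Ranking.unrank ρ u) < σ ⟨$⟩ʳ f (Ranking.unrank ρ v)) →
                       Contains σ π
  contains-by-chains {π = π} ρ f f-incr values-incr =
    f , (λ _ _ → f-incr) , λ a b → rank-<⇒value-< ∘ π-<⇒rank-< , value-<⇒π-<
    where
    open Ranking ρ
    rank-<⇒value-< : ∀ {a b} → rank a < rank b → σ ⟨$⟩ʳ f a < σ ⟨$⟩ʳ f b
    rank-<⇒value-< {a} {b} lt =
      subst (λ i → σ ⟨$⟩ʳ f i < σ ⟨$⟩ʳ f b) (unrank∘rank a)
        (subst (λ j → σ ⟨$⟩ʳ f (unrank (rank a)) < σ ⟨$⟩ʳ f j) (unrank∘rank b)
          (values-incr lt))
    π-<⇒rank-< : ∀ {a b} → lookup π a ℕ.< lookup π b → rank a < rank b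
    π-<⇒rank-< {a} {b} lt rewrite lookup≡1+rank a | lookup≡1+rank b = ℕ.s<s⁻¹ lt
    value-<⇒π-< : ∀ {a b} → σ ⟨$⟩ʳ f a < σ ⟨$⟩ʳ f b → lookup π a ℕ.< lookup π b
    value-<⇒π-< {a} {b} lt with <-cmp (rank a) (rank b)
    ... | tri< ra<rb _ _ rewrite lookup≡1+rank a | lookup≡1+rank b = s≤s ra<rb
    ... | tri≈ _ ra≡rb _ = ⊥-elim (<-irrefl (cong (λ i → σ ⟨$⟩ʳ f i) a≡b) lt)
      where a≡b = trans (sym (unrank∘rank a)) (trans (cong unrank ra≡rb) (unrank∘rank b))
    ... | tri> _ _ rb<ra = ⊥-elim (<-asym lt (rank-<⇒value-< rb<ra))

  smaller-left : ∀ {x} → NonMin σ x → ∃ λ j → j < x × σ ⟨$⟩ʳ j < σ ⟨$⟩ʳ x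
  smaller-left {x} nonMin
    with j , ¬[j<x⇒σx<σj] ← ¬∀⟶∃¬ n _ (λ j → (j <? x) →-dec (σ ⟨$⟩ʳ x <? σ ⟨$⟩ʳ j)) nonMin
    with j <? x
  ... | no j≮x = ⊥-elim (¬[j<x⇒σx<σj] (⊥-elim ∘ j≮x))
  ... | yes j<x = j , j<x , ≤∧≢⇒< (ℕ.≮⇒≥ λ σx<σj → ¬[j<x⇒σx<σj] λ _ → σx<σj)
                                  (λ σj≡σx → <-irrefl (σ-injective σj≡σx) j<x)

  private
    HasLRMinLeftBelow : Fin n → Set
    HasLRMinLeftBelow x = NonMin σ x → ∃ λ w → IsLRMin σ w × w < x × σ ⟨$⟩ʳ w < σ ⟨$⟩ʳ x

  lrmin-left-below : ∀ {x} → NonMin σ x → ∃ λ w → IsLRMin σ w × w < x × σ ⟨$⟩ʳ w < σ ⟨$⟩ʳ x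
  lrmin-left-below = WF.All.wfRec <-wellFounded _ HasLRMinLeftBelow step _
    where
    step : ∀ x → (∀ {y} → y < x → HasLRMinLeftBelow y) → HasLRMinLeftBelow x
    step x rec nonMin with j , j<x , σj<σx ← smaller-left nonMin | isLRMin? σ j
    ... | yes min = j , min , j<x , σj<σx
    ... | no nonMinʲ with w , min , w<j , σw<σj ← rec j<x nonMinʲ =
      w , min , <-trans w<j j<x , <-trans σw<σj σj<σx

  lrmin-left-of-smaller : ∀ {u w} → IsLRMin σ u → σ ⟨$⟩ʳ w < σ ⟨$⟩ʳ u → u < w
  lrmin-left-of-smaller {u} {w} min σw<σu =
    ≮∧≢⇒< (λ w<u → <-asym σw<σu (min w w<u))
          (λ u≡w → <-irrefl (cong (σ ⟨$⟩ʳ_) (sym u≡w)) σw<σu)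

  private
    lrminLeftOf? : (k : Fin n) → Decidable (λ j → j < k × IsLRMin σ j)
    lrminLeftOf? k j = (j <? k) ×-dec isLRMin? σ j

    lrminAbove? : (k : Fin n) → Decidable (λ j → σ ⟨$⟩ʳ k < σ ⟨$⟩ʳ j × IsLRMin σ j)
    lrminAbove? k j = (σ ⟨$⟩ʳ k <? σ ⟨$⟩ʳ j) ×-dec isLRMin? σ j

    nonMin-≢ : ∀ {m y} → IsLRMin σ m → NonMin σ y → m ≢ y
    nonMin-≢ min nonMin refl = nonMin min

  column-<⇒lrmin-between : ∀ {x y} → NonMin σ x → column σ x ℕ.< column σ y →
                           ∃ λ m → IsLRMin σ m × x < m × m < y
  column-<⇒lrmin-between {x} {y} nonMin lt
    with m , (m<y , min) , ¬[m<x×min]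
           ← length-filter-<⇒∃ (lrminLeftOf? x) (lrminLeftOf? y) (allFin n) lt =
    m , min , ≮∧≢⇒< (λ m<x → ¬[m<x×min] (m<x , min)) (nonMin-≢ min nonMin ∘ sym) , m<y

  row-<⇒lrmin-between : ∀ {x y} → NonMin σ y → row σ y ℕ.< row σ x →
                        ∃ λ u → IsLRMin σ u × σ ⟨$⟩ʳ x < σ ⟨$⟩ʳ u × σ ⟨$⟩ʳ u < σ ⟨$⟩ʳ y
  row-<⇒lrmin-between {x} {y} nonMin lt
    with u , (σx<σu , min) , ¬[σy<σu×min]
           ← length-filter-<⇒∃ (lrminAbove? y) (lrminAbove? x) (allFin n) (ℕ.s<s⁻¹ lt) =
    u , min , σx<σu ,
      ≮∧≢⇒< (λ σy<σu → ¬[σy<σu×min] (σy<σu , min)) (nonMin-≢ min nonMin ∘ σ-injective)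

  column-≡⇒lrmin-left : ∀ {x y w} → NonMin σ y → column σ x ≡ column σ y →
                        IsLRMin σ w → w < x → w < y
  column-≡⇒lrmin-left {x} {y} {w} nonMin same min w<x = ≮∧≢⇒< y≮w (nonMin-≢ min nonMin)
    where
    y≮w : ¬ y < w
    y≮w y<w = ℕ.<-irrefl (sym same)
      (length-filter-mono-< (lrminLeftOf? y) (lrminLeftOf? x)
        (λ (j<y , minʲ) → <-trans j<y (<-trans y<w w<x) , minʲ)
        (∈-allFin w) (w<x , min) (λ (w<y , _) → <-asym w<y y<w))

  row-≡⇒lrmin-below : ∀ {x y w} → NonMin σ y → row σ x ≡ row σ y →
                      IsLRMin σ w → σ ⟨$⟩ʳ w < σ ⟨$⟩ʳ x → σ ⟨$⟩ʳ w < σ ⟨$⟩ʳ y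
  row-≡⇒lrmin-below {x} {y} {w} nonMin same min σw<σx =
    ≮∧≢⇒< σy≮σw (nonMin-≢ min nonMin ∘ σ-injective)
    where
    σy≮σw : ¬ σ ⟨$⟩ʳ y < σ ⟨$⟩ʳ w
    σy≮σw σy<σw = ℕ.<-irrefl (ℕ.suc-injective same)
      (length-filter-mono-< (lrminAbove? x) (lrminAbove? y)
        (λ (σx<σj , minʲ) → <-trans σy<σw (<-trans σw<σx σx<σj) , minʲ)
        (∈-allFin w) (σy<σw , min) (λ (σx<σw , _) → <-asym σx<σw σw<σx))

  rows-decreasing : Avoids σ p2314 → RowsDecreasing σ
  rows-decreasing avoid x y nonMinˣ _ _ cx<cy =
    ≮∧≢⇒< σx≮σy (λ σy≡σx → ℕ.<-irrefl (cong (column σ) (σ-injective (sym σy≡σx))) cx<cy)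
    where
    σx≮σy : ¬ σ ⟨$⟩ʳ x < σ ⟨$⟩ʳ y
    σx≮σy σx<σy
      with m , minᵐ , x<m , m<y ← column-<⇒lrmin-between nonMinˣ cx<cy
         | w , _ , w<x , σw<σx ← lrmin-left-below nonMinˣ =
      avoid (contains-by-chains ranking2314 (lookup (w ∷ x ∷ m ∷ y ∷ []))
               (chain₄ w<x x<m m<y)
               (chain₄ (minᵐ w (<-trans w<x x<m)) σw<σx σx<σy))

  rows-increasing : Avoids σ p2413 → RowsIncreasing σ
  rows-increasing avoid x y nonMinˣ nonMinʸ same cx<cy =
    ≮∧≢⇒< σy≮σx (λ σx≡σy → ℕ.<-irrefl (cong (column σ) (σ-injective σx≡σy)) cx<cy)
    where
    σy≮σx : ¬ σ ⟨$⟩ʳ y < σ ⟨$⟩ʳ x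
    σy≮σx σy<σx
      with m , minᵐ , x<m , m<y ← column-<⇒lrmin-between nonMinˣ cx<cy
         | w , minʷ , w<x , σw<σx ← lrmin-left-below nonMinˣ =
      avoid (contains-by-chains ranking2413 (lookup (w ∷ x ∷ m ∷ y ∷ []))
               (chain₄ w<x x<m m<y)
               (chain₄ (minᵐ w (<-trans w<x x<m))
                  (row-≡⇒lrmin-below nonMinʸ same minʷ σw<σx) σy<σx))

  columns-decreasing : Avoids σ p3124 → ColumnsDecreasing σ
  columns-decreasing avoid x y nonMinˣ nonMinʸ _ ry<rx =
    ≮∧≢⇒< x≮y (λ y≡x → ℕ.<-irrefl (cong (row σ) y≡x) ry<rx)
    where
    x≮y : ¬ x < y
    x≮y x<y
      with u , minᵘ , σx<σu , σu<σy ← row-<⇒lrmin-between nonMinʸ ry<rx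
         | w , _ , w<x , σw<σx ← lrmin-left-below nonMinˣ =
      avoid (contains-by-chains ranking3124 (lookup (u ∷ w ∷ x ∷ y ∷ []))
               (chain₄ (lrmin-left-of-smaller minᵘ (<-trans σw<σx σx<σu)) w<x x<y)
               (chain₄ σw<σx σx<σu σu<σy))

  columns-increasing : Avoids σ p3142 → ColumnsIncreasing σ
  columns-increasing avoid x y nonMinˣ nonMinʸ same ry<rx =
    ≮∧≢⇒< y≮x (λ x≡y → ℕ.<-irrefl (cong (row σ) (sym x≡y)) ry<rx)
    where
    y≮x : ¬ y < x
    y≮x y<x
      with u , minᵘ , σx<σu , σu<σy ← row-<⇒lrmin-between nonMinʸ ry<rx
         | w , minʷ , w<x , σw<σx ← lrmin-left-below nonMinˣ =
      avoid (contains-by-chains ranking3142 (lookup (u ∷ w ∷ y ∷ x ∷ []))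
               (chain₄ (lrmin-left-of-smaller minᵘ (<-trans σw<σx σx<σu))
                  (column-≡⇒lrmin-left nonMinʸ same minʷ w<x) y<x)
               (chain₄ σw<σx σx<σu σu<σy))

lemma3p1 : (n : ℕ) (σ : Permutation′ n) →
    (Avoids σ p2314 → RowsDecreasing σ) ×
    (Avoids σ p3124 → ColumnsDecreasing σ) ×
    (Avoids σ p2413 → RowsIncreasing σ) ×
    (Avoids σ p3142 → ColumnsIncreasing σ)
lemma3p1 n σ =
  rows-decreasing σ , columns-decreasing σ , rows-increasing σ , columns-increasing σ
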